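{- Let $G$ be a looped simple graph with adjacency matrix $M$ over $\mathbb{F}_2$. Then for every $A\subseteq V(G)$, \[ w(D(G)*A)=\operatorname{rank}(M[A])+\operatorname{rank}(M[A^c]), \] where $A^c=V(G)\setminus A$ and ranks are over $\mathbb{F}_2$. In particular, \[ T_G(z)=\sum_{A\subseteq V(G)} z^{\operatorname{rank}(M[A])+\operatorname{rank}(M[A^c])}. \]
   Context: A looped simple graph allows at most one loop per vertex and no multiple edges; its adjacency matrix over $\mathbb{F}_2$ has $M_{uv}=1$ iff distinct $u,v$ are adjacent and $M_{vv}=1$ iff $v$ has a loop. $M[S]$ is the principal submatrix indexed by $S$, with $M[\emptyset]$ nonsingular and of rank $0$ by convention. $D(G)=(V(G),\{S: M[S]\text{ nonsingular}\})$. For a set system $D=(E,\mathcal{F})$ and $A\subseteq E$: $D*A=(E,\{X\triangle A:X\in\mathcal{F}\})$, $w(D)=\max_{F\in\mathcal{F}}|F|-\min_{F\in\mathcal{F}}|F|$, and $T_D(z)=\sum_{A\subseteq E}z^{w(D*A)}$; $T_G=T_{D(G)}$. -}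

module Defs where

open import Data.Bool using (Bool; true; false; _∧_; _xor_; not)
open import Data.Nat using (ℕ; zero; suc; _+_; _∸_; _^_; _⊔_; _⊓_)
open import Data.Fin using (Fin)
open import Data.Fin.Subset using (Subset; ∣_∣; ∁)
open import Data.Vec using (Vec; []; _∷_; lookup; zipWith)
open import Data.List using (List; []; _∷_; [_]; map; _++_; filterᵇ; foldr)
open import Data.Nat.ListAction using (sum)
open import Relation.Binary.PropositionalEquality using (_≡_)

-- Vertex set V(G) = Fin n.  Adjacency matrix over F₂ = Bool (xor as +, ∧ as ·).
Matrix : ℕ → Set
Matrix n = Fin n → Fin n → Bool

-- A looped simple graph on Fin n is given by its adjacency matrix: a symmetric
-- 0/1 matrix whose diagonal entries record loops (at most one loop per vertex,
-- no multiple edges).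
record LoopedSimpleGraph (n : ℕ) : Set where
  field
    adj : Matrix n
    sym : ∀ u v → adj u v ≡ adj v u

open LoopedSimpleGraph public

adjMatrix : ∀ {n} → LoopedSimpleGraph n → Matrix n
adjMatrix G = adj G

_∈ₛ_ : ∀ {n} → Fin n → Subset n → Bool
v ∈ₛ S = lookup S v

_⊆ᵇ_ : ∀ {n} → Subset n → Subset n → Bool
[] ⊆ᵇ [] = true
(r ∷ R) ⊆ᵇ (s ∷ S) = (not r Data.Bool.∨ s) ∧ (R ⊆ᵇ S)

nonempty : ∀ {n} → Subset n → Bool
nonempty [] = false
nonempty (x ∷ R) = x Data.Bool.∨ nonempty R

subsets : ∀ n → List (Subset n)
subsets zero = [ [] ]
subsets (suc n) = map (false ∷_) (subsets n) ++ map (true ∷_) (subsets n)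

xorSum : ∀ {n} → (Fin n → Bool) → Bool
xorSum {zero} f = false
xorSum {suc n} f = f Data.Fin.zero xor xorSum (λ i → f (Data.Fin.suc i))

allᵇ : ∀ {n} → (Fin n → Bool) → Bool
allᵇ {zero} f = true
allᵇ {suc n} f = f Data.Fin.zero ∧ allᵇ (λ i → f (Data.Fin.suc i))

combZero : ∀ {n} → Matrix n → Subset n → Subset n → Bool
combZero M S R = allᵇ (λ v → not (v ∈ₛ S) Data.Bool.∨
                              not (xorSum (λ u → (u ∈ₛ R) ∧ M u v)))

rowsIndep : ∀ {n} → Matrix n → Subset n → Subset n → Bool
rowsIndep {n} M S R =
  allL (λ R' → not (R' ⊆ᵇ R ∧ nonempty R') Data.Bool.∨ not (combZero M S R'))
       (subsets n)
  where
  allL : (Subset n → Bool) → List (Subset n) → Bool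
  allL p = foldr (λ x b → p x ∧ b) true

-- maximum / minimum of a list of naturals (minimum of [] is 0 by convention;
-- it is never used on an empty list below)
maxL : List ℕ → ℕ
maxL = foldr _⊔_ 0

minL : List ℕ → ℕ
minL [] = 0
minL (x ∷ xs) = foldr _⊓_ x xs

rank : ∀ {n} → Matrix n → Subset n → ℕ
rank {n} M S =
  maxL (map ∣_∣ (filterᵇ (λ R → R ⊆ᵇ S ∧ rowsIndep M S R) (subsets n)))

-- M[S] is nonsingular: its rows are linearly independent (M[∅] is nonsingular).
nonsingular : ∀ {n} → Matrix n → Subset n → Bool
nonsingular M S = rowsIndep M S S

SetSystem : ℕ → Set
SetSystem n = List (Subset n)

_△_ : ∀ {n} → Subset n → Subset n → Subset n
X △ A = zipWith _xor_ X A

DG : ∀ {n} → LoopedSimpleGraph n → SetSystem n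
DG {n} G = filterᵇ (nonsingular (adjMatrix G)) (subsets n)

_*ₛ_ : ∀ {n} → SetSystem n → Subset n → SetSystem n
D *ₛ A = map (λ X → X △ A) D

width : ∀ {n} → SetSystem n → ℕ
width D = maxL (map ∣_∣ D) ∸ minL (map ∣_∣ D)

-- T_D(z) = Σ_{A ⊆ E} z^{w(D*A)}, evaluated at z ∈ ℕ
Tpoly : ∀ {n} → SetSystem n → ℕ → ℕ
Tpoly {n} D z = sum (map (λ A → z ^ width (D *ₛ A)) (subsets n))

TG : ∀ {n} → LoopedSimpleGraph n → ℕ → ℕ
TG G = Tpoly (DG G)

-- Write f(X) = ∣X △ A∣, so that w(D(G) * A) is the spread of f over the sets X with
-- M[X] nonsingular. Counting gives f(X) + ∣X ∩ A∣ = ∣A∣ + ∣X ∖ A∣. The rows of M[X]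
-- indexed by X ∩ B are independent, and deleting the ∣X ∖ B∣ columns outside B costs
-- at most one unit of rank per column, so ∣X ∩ B∣ ≤ rank M[B] + ∣X ∖ B∣. Taking
-- B = A and B = Aᶜ yields ∣A∣ - rank M[A] ≤ f(X) ≤ ∣A∣ + rank M[Aᶜ]. Both bounds are
-- attained, by X ⊆ A and X ⊆ Aᶜ, because a symmetric matrix M[S] has a nonsingular
-- principal submatrix of size rank M[S]: a maximal independent set R of rows of M[S]
-- spans all its rows, and by symmetry also all its columns, so M[R] is nonsingular.

module Submission where

open import Defs hiding (sym)
open import Data.Nat using (ℕ; _+_; _^_)
open import Data.Fin.Subset using (Subset; ∁)
open import Data.List using (map)
open import Data.Nat.ListAction using (sum)
open import Data.Product using (_×_)
open import Relation.Binary.PropositionalEquality using (_≡_)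

open import Algebra.Bundles using (CommutativeRing)
open import Data.Bool using (Bool; true; false; _∧_; _∨_; _xor_; not; T; T?; _≟_)
open import Data.Bool.Properties
  using ( xor-∧-commutativeRing; ∧-commutativeMonoid; ∧-distribʳ-xor; ∧-zeroʳ; xor-identityʳ
        ; T-≡; T-∧ )
open import Data.Empty using (⊥-elim)
open import Data.Fin using (Fin; zero; suc)
import Data.Fin as Fin
open import Data.Fin.Properties using (decFinSubset)
open import Data.Fin.Subset
  using (_∈_; _∉_; _⊆_; _⊂_; Nonempty; ⊥; ⁅_⁆; ∣_∣; _∩_; _∪_; _-_; inside; outside)
open import Data.Fin.Subset.Properties
  using ( _∈?_; _⊆?_; nonempty?; anySubset?; ⊥⊆; ∉⊥; ∣⊥∣≡0; x∈⁅x⁆; x∈⁅y⁆⇒x≡y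
        ; p─⊥≡p; p─q⊆p; x∈p∧x≢y⇒x∈p-y; x∈p∩q⁺; p∩q⊆p; p∩q⊆q; x∈p∪q⁺; x∈p∪q⁻; p⊆p∪q
        ; p⊆q⇒∣p∣≤∣q∣; p⊂q⇒∣p∣<∣q∣; x∉p⇒x∈∁p; out⊆; in⊆in; drop-∷-⊆ )
open import Data.List using (List; []; _∷_; filterᵇ)
open import Data.Bool.ListAction using (all)
open import Data.List.Membership.Propositional using () renaming (_∈_ to _∈ˡ_)
open import Data.List.Membership.Propositional.Properties
  using (∈-map⁺; ∈-map⁻; ∈-++⁺ˡ; ∈-++⁺ʳ; ∈-filter⁺; ∈-filter⁻; foldr-selective)
open import Data.List.Properties using (foldr-map; foldr-preservesᵇ; foldr-preservesᵒ; map-cong)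
open import Data.List.Relation.Unary.All as All using (All)
open import Data.List.Relation.Unary.All.Properties using (all⁺; all⁻; map⁺)
import Data.List.Relation.Unary.Any as Any
open import Data.Nat using (zero; suc; _∸_; _≤_; z≤n; s≤s)
open import Data.Nat.Properties
  using ( ≤-reflexive; ≤-antisym; ≤-trans; ≤⇒≯; n≤1+n; m≤m+n; suc-injective; +-suc; +-assoc; +-comm
        ; +-monoˡ-≤; +-monoʳ-≤; +-cancelʳ-≤; m≤n+o⇒m∸n≤o; +-∸-comm; m∸n≤m; m∸[m∸n]≡n; m+n∸n≡m
        ; ⊔-sel; ⊔-lub; ⊓-glb; m≤n⇒m≤n⊔o; m≤n⇒m≤o⊔n; m≤n⇒m⊓o≤n; m≤n⇒o⊓m≤n; module ≤-Reasoning )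
open import Data.Product using (∃-syntax; _,_; proj₁; proj₂)
import Data.Product
open import Data.Sum using (_⊎_; inj₁; inj₂; [_,_]′)
import Data.Sum
open import Data.Vec using (lookup; []; _∷_; here; there)
open import Data.Vec.Properties using ([]=⇒lookup; lookup⇒[]=; lookup-zipWith)
open import Function using (_∘_; id; _⇔_; mk⇔; Equivalence)
open import Relation.Binary.PropositionalEquality
  using (_≢_; refl; sym; trans; cong; cong₂; subst; module ≡-Reasoning)
open import Relation.Nullary using (¬_; Dec; yes; no; contradiction; _×-dec_)

open Equivalence using (to; from)

private
  module F₂ = CommutativeRing xor-∧-commutativeRing

open import Algebra.Properties.Semiring.Sum F₂.semiring
  using (sum-cong-≗; ∑-distrib-+; ∑-comm; *-distribˡ-sum; sum-replicate-zero)
  renaming (sum to ∑)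
open import Algebra.Properties.CommutativeSemigroup
  (Algebra.Bundles.CommutativeMonoid.commutativeSemigroup ∧-commutativeMonoid)
  using (x∙yz≈y∙xz)

private
  variable
    n : ℕ

-- Sums over F₂

sumOver : Subset n → (Fin n → Bool) → Bool
sumOver T f = ∑ (λ u → (u ∈ₛ T) ∧ f u)

T-lookup : ∀ {p : Subset n} {x} → T (x ∈ₛ p) ⇔ x ∈ p
T-lookup {p = p} {x} = mk⇔ (λ t → lookup⇒[]= x p (to T-≡ t)) (λ x∈p → from T-≡ ([]=⇒lookup x∈p))

sumOver-cong : ∀ (T' : Subset n) {f g} → (∀ {t} → t ∈ T' → f t ≡ g t) → sumOver T' f ≡ sumOver T' g
sumOver-cong T' {f} {g} f≗g = sum-cong-≗ pointwise
  where
  pointwise : ∀ t → (t ∈ₛ T') ∧ f t ≡ (t ∈ₛ T') ∧ g t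
  pointwise t with t ∈ₛ T' in t∈T'
  ... | false = refl
  ... | true  = cong (true ∧_) (f≗g (to T-lookup (subst T (sym t∈T') _)))

sumOver-zero : ∀ (T' : Subset n) {f} → (∀ {t} → t ∈ T' → f t ≡ false) → sumOver T' f ≡ false
sumOver-zero {n} T' {f} f≡0 = begin
  sumOver T' f                 ≡⟨ sumOver-cong T' f≡0 ⟩
  ∑ (λ u → (u ∈ₛ T') ∧ false) ≡⟨ sum-cong-≗ {n} (λ u → ∧-zeroʳ (u ∈ₛ T')) ⟩
  ∑ {n} (λ _ → false)          ≡⟨ sum-replicate-zero n ⟩
  false                        ∎
  where open ≡-Reasoning

sumOver-△ : ∀ (T₁ T₂ : Subset n) f → sumOver (T₁ △ T₂) f ≡ sumOver T₁ f xor sumOver T₂ f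
sumOver-△ {n} T₁ T₂ f =
  trans (sum-cong-≗ {n} pointwise) (∑-distrib-+ {n} (λ u → (u ∈ₛ T₁) ∧ f u) (λ u → (u ∈ₛ T₂) ∧ f u))
  where
  pointwise : ∀ u → (u ∈ₛ (T₁ △ T₂)) ∧ f u ≡ ((u ∈ₛ T₁) ∧ f u) xor ((u ∈ₛ T₂) ∧ f u)
  pointwise u = trans (cong (_∧ f u) (lookup-zipWith _xor_ u T₁ T₂))
                      (∧-distribʳ-xor (f u) (u ∈ₛ T₁) (u ∈ₛ T₂))

sumOver-⁅⁆ : ∀ (x : Fin n) f → sumOver ⁅ x ⁆ f ≡ f x
sumOver-⁅⁆ zero    f = begin
  f zero xor sumOver ⊥ (f ∘ suc) ≡⟨ cong (f zero xor_) (sumOver-zero ⊥ {f ∘ suc} (⊥-elim ∘ ∉⊥)) ⟩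
  f zero xor false               ≡⟨ xor-identityʳ (f zero) ⟩
  f zero                         ∎
  where open ≡-Reasoning
sumOver-⁅⁆ (suc x) f = sumOver-⁅⁆ x (f ∘ suc)

sumOver-comm : ∀ (T₁ T₂ : Subset n) (g : Fin n → Fin n → Bool) →
               sumOver T₁ (λ t → sumOver T₂ (λ u → g u t))
               ≡ sumOver T₂ (λ u → sumOver T₁ (λ t → g u t))
sumOver-comm {n} T₁ T₂ g = begin
  ∑ (λ t → (t ∈ₛ T₁) ∧ ∑ (λ u → (u ∈ₛ T₂) ∧ g u t))
    ≡⟨ sum-cong-≗ {n} (λ t → *-distribˡ-sum (t ∈ₛ T₁) (λ u → (u ∈ₛ T₂) ∧ g u t)) ⟩
  ∑ (λ t → ∑ (λ u → (t ∈ₛ T₁) ∧ ((u ∈ₛ T₂) ∧ g u t)))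
    ≡⟨ ∑-comm {n} {n} (λ t u → (t ∈ₛ T₁) ∧ ((u ∈ₛ T₂) ∧ g u t)) ⟩
  ∑ (λ u → ∑ (λ t → (t ∈ₛ T₁) ∧ ((u ∈ₛ T₂) ∧ g u t)))
    ≡⟨ sum-cong-≗ {n} (λ u → sum-cong-≗ {n} (λ t → x∙yz≈y∙xz (t ∈ₛ T₁) (u ∈ₛ T₂) (g u t))) ⟩
  ∑ (λ u → ∑ (λ t → (u ∈ₛ T₂) ∧ ((t ∈ₛ T₁) ∧ g u t)))
    ≡⟨ sum-cong-≗ {n} (λ u → sym (*-distribˡ-sum (u ∈ₛ T₂) (λ t → (t ∈ₛ T₁) ∧ g u t))) ⟩
  ∑ (λ u → (u ∈ₛ T₂) ∧ ∑ (λ t → (t ∈ₛ T₁) ∧ g u t))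
    ∎
  where open ≡-Reasoning

x∈p△q⁻ : ∀ {p q : Subset n} {x} → x ∈ p △ q → x ∈ p ⊎ x ∈ q
x∈p△q⁻ {p = inside  ∷ p} {outside ∷ q} here       = inj₁ here
x∈p△q⁻ {p = outside ∷ p} {inside  ∷ q} here       = inj₂ here
x∈p△q⁻ {p = _       ∷ p} {_       ∷ q} (there x∈) = Data.Sum.map there there (x∈p△q⁻ x∈)

x∈p∧x∉q⇒x∈p△q : ∀ {p q : Subset n} {x} → x ∈ p → x ∉ q → x ∈ p △ q
x∈p∧x∉q⇒x∈p△q {q = outside ∷ q} here        x∉q = here
x∈p∧x∉q⇒x∈p△q {q = inside  ∷ q} here        x∉q = contradiction here x∉q
x∈p∧x∉q⇒x∈p△q {q = _       ∷ q} (there x∈p) x∉q = there (x∈p∧x∉q⇒x∈p△q x∈p (x∉q ∘ there))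

x∈p∧x∈q⇒x∉p△q : ∀ {p q : Subset n} {x} → x ∈ p → x ∈ q → x ∉ p △ q
x∈p∧x∈q⇒x∉p△q {p = _ ∷ p} {_ ∷ q} here        here        ()
x∈p∧x∈q⇒x∉p△q {p = _ ∷ p} {_ ∷ q} (there x∈p) (there x∈q) (there x∈) = x∈p∧x∈q⇒x∉p△q x∈p x∈q x∈

∈⊎∈∁ : ∀ (p : Subset n) x → x ∈ p ⊎ x ∈ ∁ p
∈⊎∈∁ p x with x ∈? p
... | yes x∈p = inj₁ x∈p
... | no  x∉p = inj₂ (x∉p⇒x∈∁p x∉p)

x∈p∪⁅y⁆∧x≢y⇒x∈p : ∀ {p : Subset n} {x y} → x ∈ p ∪ ⁅ y ⁆ → x ≢ y → x ∈ p
x∈p∪⁅y⁆∧x≢y⇒x∈p {p = p} {y = y} x∈ x≢y =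
  [ id , (λ x∈⁅y⁆ → contradiction (x∈⁅y⁆⇒x≡y y x∈⁅y⁆) x≢y) ]′ (x∈p∪q⁻ p ⁅ y ⁆ x∈)

x∉p-x : ∀ {p : Subset n} {x} → x ∉ p - x
x∉p-x {p = _ ∷ p} {suc x} (there x∈) = x∉p-x x∈

∣p∣≡1+∣p-x∣ : ∀ {p : Subset n} {x} → x ∈ p → ∣ p ∣ ≡ suc ∣ p - x ∣
∣p∣≡1+∣p-x∣ {p = inside  ∷ p} here        = cong (suc ∘ ∣_∣) (sym (p─⊥≡p p))
∣p∣≡1+∣p-x∣ {p = inside  ∷ p} (there x∈p) = cong suc (∣p∣≡1+∣p-x∣ x∈p)
∣p∣≡1+∣p-x∣ {p = outside ∷ p} (there x∈p) = ∣p∣≡1+∣p-x∣ x∈p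

∣p△q∣+∣p∩q∣≡∣q∣+∣p∩∁q∣ : ∀ (p q : Subset n) → ∣ p △ q ∣ + ∣ p ∩ q ∣ ≡ ∣ q ∣ + ∣ p ∩ ∁ q ∣
∣p△q∣+∣p∩q∣≡∣q∣+∣p∩∁q∣ []            []            = refl
∣p△q∣+∣p∩q∣≡∣q∣+∣p∩∁q∣ (outside ∷ p) (outside ∷ q) = ∣p△q∣+∣p∩q∣≡∣q∣+∣p∩∁q∣ p q
∣p△q∣+∣p∩q∣≡∣q∣+∣p∩∁q∣ (outside ∷ p) (inside  ∷ q) = cong suc (∣p△q∣+∣p∩q∣≡∣q∣+∣p∩∁q∣ p q)
∣p△q∣+∣p∩q∣≡∣q∣+∣p∩∁q∣ (inside  ∷ p) (outside ∷ q) =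
  trans (cong suc (∣p△q∣+∣p∩q∣≡∣q∣+∣p∩∁q∣ p q)) (sym (+-suc _ _))
∣p△q∣+∣p∩q∣≡∣q∣+∣p∩∁q∣ (inside  ∷ p) (inside  ∷ q) =
  trans (+-suc _ _) (cong suc (∣p△q∣+∣p∩q∣≡∣q∣+∣p∩∁q∣ p q))

p⊆∁q⇒∣p△q∣≡∣q∣+∣p∣ : ∀ {p q : Subset n} → p ⊆ ∁ q → ∣ p △ q ∣ ≡ ∣ q ∣ + ∣ p ∣
p⊆∁q⇒∣p△q∣≡∣q∣+∣p∣ {p = []}          {[]}          _    = refl
p⊆∁q⇒∣p△q∣≡∣q∣+∣p∣ {p = outside ∷ p} {outside ∷ q} p⊆∁q = p⊆∁q⇒∣p△q∣≡∣q∣+∣p∣ (drop-∷-⊆ p⊆∁q)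
p⊆∁q⇒∣p△q∣≡∣q∣+∣p∣ {p = outside ∷ p} {inside  ∷ q} p⊆∁q =
  cong suc (p⊆∁q⇒∣p△q∣≡∣q∣+∣p∣ (drop-∷-⊆ p⊆∁q))
p⊆∁q⇒∣p△q∣≡∣q∣+∣p∣ {p = inside  ∷ p} {outside ∷ q} p⊆∁q =
  trans (cong suc (p⊆∁q⇒∣p△q∣≡∣q∣+∣p∣ (drop-∷-⊆ p⊆∁q))) (sym (+-suc _ _))
p⊆∁q⇒∣p△q∣≡∣q∣+∣p∣ {p = inside  ∷ p} {inside  ∷ q} p⊆∁q with p⊆∁q here
... | ()

p⊆q⇒∣p△q∣+∣p∣≡∣q∣ : ∀ {p q : Subset n} → p ⊆ q → ∣ p △ q ∣ + ∣ p ∣ ≡ ∣ q ∣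
p⊆q⇒∣p△q∣+∣p∣≡∣q∣ {p = []}          {[]}          _   = refl
p⊆q⇒∣p△q∣+∣p∣≡∣q∣ {p = outside ∷ p} {outside ∷ q} p⊆q = p⊆q⇒∣p△q∣+∣p∣≡∣q∣ (drop-∷-⊆ p⊆q)
p⊆q⇒∣p△q∣+∣p∣≡∣q∣ {p = outside ∷ p} {inside  ∷ q} p⊆q = cong suc (p⊆q⇒∣p△q∣+∣p∣≡∣q∣ (drop-∷-⊆ p⊆q))
p⊆q⇒∣p△q∣+∣p∣≡∣q∣ {p = inside  ∷ p} {inside  ∷ q} p⊆q =
  trans (+-suc _ _) (cong suc (p⊆q⇒∣p△q∣+∣p∣≡∣q∣ (drop-∷-⊆ p⊆q)))
p⊆q⇒∣p△q∣+∣p∣≡∣q∣ {p = inside  ∷ p} {outside ∷ q} p⊆q with p⊆q here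
... | ()

∈⇒≤maxL : ∀ {x xs} → x ∈ˡ xs → x ≤ maxL xs
∈⇒≤maxL {x} {xs} x∈xs =
  foldr-preservesᵒ (λ a b → [ m≤n⇒m≤n⊔o b , m≤n⇒m≤o⊔n a ]′) 0 xs (inj₂ (Any.map ≤-reflexive x∈xs))

maxL-≡ : ∀ {m xs} → m ∈ˡ xs → All (_≤ m) xs → maxL xs ≡ m
maxL-≡ m∈xs xs≤m = ≤-antisym (foldr-preservesᵇ ⊔-lub z≤n xs≤m) (∈⇒≤maxL m∈xs)

minL-≡ : ∀ {m xs} → m ∈ˡ xs → All (m ≤_) xs → minL xs ≡ m
minL-≡ {m} {x ∷ xs} m∈x∷xs (m≤x All.∷ m≤xs) =
  ≤-antisym (foldr-preservesᵒ (λ a b → [ m≤n⇒m⊓o≤n b , m≤n⇒o⊓m≤n a ]′) x xs (attained m∈x∷xs))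
            (foldr-preservesᵇ ⊓-glb m≤x m≤xs)
  where
  attained : m ∈ˡ x ∷ xs → x ≤ m ⊎ Any.Any (_≤ m) xs
  attained (Any.here m≡x)   = inj₁ (≤-reflexive (sym m≡x))
  attained (Any.there m∈xs) = inj₂ (Any.map (≤-reflexive ∘ sym) m∈xs)

-- Linear dependence of rows over F₂

IsSymmetric : Matrix n → Set
IsSymmetric M = ∀ u v → M u v ≡ M v u

rowSum : Matrix n → (rows : Subset n) → Fin n → Bool
rowSum M R v = sumOver R (λ u → M u v)

Vanishes : Matrix n → (columns rows : Subset n) → Set
Vanishes M C R = ∀ {v} → v ∈ C → rowSum M R v ≡ false

Dependent : Matrix n → (columns rows : Subset n) → Set
Dependent M C R = ∃[ T' ] T' ⊆ R × Nonempty T' × Vanishes M C T'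

Independent : Matrix n → (columns rows : Subset n) → Set
Independent M C R = ¬ Dependent M C R

module _ {M : Matrix n} where

  vanishes? : ∀ C R → Dec (Vanishes M C R)
  vanishes? C R = decFinSubset (_∈? C) (λ {v} _ → rowSum M R v ≟ false)

  dependent? : ∀ C R → Dec (Dependent M C R)
  dependent? C R = anySubset? (λ T' → T' ⊆? R ×-dec nonempty? T' ×-dec vanishes? C T')

  vanishes-△ : ∀ {C R₁ R₂} → Vanishes M C R₁ → Vanishes M C R₂ → Vanishes M C (R₁ △ R₂)
  vanishes-△ {R₁ = R₁} {R₂} R₁-van R₂-van {v} v∈C =
    trans (sumOver-△ R₁ R₂ (λ u → M u v)) (cong₂ _xor_ (R₁-van v∈C) (R₂-van v∈C))

  independent-antitone-rows : ∀ {C R R'} → R' ⊆ R → Independent M C R → Independent M C R'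
  independent-antitone-rows R'⊆R R-indep (T' , T'⊆R' , T'≢∅ , T'-van) =
    R-indep (T' , R'⊆R ∘ T'⊆R' , T'≢∅ , T'-van)

  independent-monotone-columns : ∀ {C C' R} → C ⊆ C' → Independent M C R → Independent M C' R
  independent-monotone-columns C⊆C' R-indep (T' , T'⊆R , T'≢∅ , T'-van) =
    R-indep (T' , T'⊆R , T'≢∅ , T'-van ∘ C⊆C')

  independent-delete-column : ∀ {C C' P} c → (∀ {v} → v ∈ C → v ∈ C' ⊎ v ≡ c) →
    Independent M C P → ∃[ P' ] P' ⊆ P × ∣ P ∣ ≤ suc ∣ P' ∣ × Independent M C' P'
  independent-delete-column {C} {C'} {P} c C⊆C'+c P-indep with dependent? C' P
  ... | no P-indep' = P , id , n≤1+n ∣ P ∣ , P-indep'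
  ... | yes (T₁ , T₁⊆P , (t , t∈T₁) , T₁-van) =
    P - t , p─q⊆p P ⁅ t ⁆ , ≤-reflexive (∣p∣≡1+∣p-x∣ (T₁⊆P t∈T₁)) , P-t-indep
    where
    vanishes-on-C : ∀ {R} → Vanishes M C' R → rowSum M R c ≡ false → Vanishes M C R
    vanishes-on-C R-van Rc≡0 v∈C with C⊆C'+c v∈C
    ... | inj₁ v∈C' = R-van v∈C'
    ... | inj₂ refl = Rc≡0

    P-t-indep : Independent M C' (P - t)
    P-t-indep (T₂ , T₂⊆P-t , T₂≢∅ , T₂-van) with rowSum M T₁ c in T₁c | rowSum M T₂ c in T₂c
    ... | false | _     = P-indep (T₁ , T₁⊆P , (t , t∈T₁) , vanishes-on-C {T₁} T₁-van T₁c)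
    ... | true  | false = P-indep (T₂ , T₂⊆P , T₂≢∅ , vanishes-on-C {T₂} T₂-van T₂c)
      where
      T₂⊆P : T₂ ⊆ P
      T₂⊆P x∈T₂ = p─q⊆p P ⁅ t ⁆ (T₂⊆P-t x∈T₂)
    -- Both row sums are nonzero in column c, so their sum vanishes there.
    ... | true  | true  =
      P-indep (T₁ △ T₂ , T₁△T₂⊆P , (t , t∈T₁△T₂) , vanishes-on-C {T₁ △ T₂} T₁△T₂-van T₁△T₂c)
      where
      T₁△T₂⊆P : T₁ △ T₂ ⊆ P
      T₁△T₂⊆P x∈ = [ T₁⊆P , (λ x∈T₂ → p─q⊆p P ⁅ t ⁆ (T₂⊆P-t x∈T₂)) ]′ (x∈p△q⁻ x∈)
      t∈T₁△T₂ : t ∈ T₁ △ T₂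
      t∈T₁△T₂ = x∈p∧x∉q⇒x∈p△q t∈T₁ (x∉p-x ∘ T₂⊆P-t)
      T₁△T₂-van : Vanishes M C' (T₁ △ T₂)
      T₁△T₂-van = vanishes-△ {R₁ = T₁} {T₂} T₁-van T₂-van
      T₁△T₂c : rowSum M (T₁ △ T₂) c ≡ false
      T₁△T₂c = trans (sumOver-△ T₁ T₂ (λ u → M u c)) (cong₂ _xor_ T₁c T₂c)

  independent-delete-columns : ∀ {C D P} E → (∀ {v} → v ∈ C → v ∈ D ⊎ v ∈ E) →
    Independent M C P → ∃[ R ] R ⊆ P × ∣ P ∣ ≤ ∣ R ∣ + ∣ E ∣ × Independent M D R
  independent-delete-columns E = go ∣ E ∣ E refl
    where
    go : ∀ k {C D P} E → ∣ E ∣ ≡ k → (∀ {v} → v ∈ C → v ∈ D ⊎ v ∈ E) →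
         Independent M C P → ∃[ R ] R ⊆ P × ∣ P ∣ ≤ ∣ R ∣ + k × Independent M D R
    go k {C} {D} {P} E ∣E∣≡k C⊆D+E P-indep with nonempty? E | k
    ... | no E≡∅ | k = P , id , m≤m+n ∣ P ∣ k , independent-monotone-columns C⊆D P-indep
      where
      C⊆D : C ⊆ D
      C⊆D v∈C = [ id , (λ v∈E → contradiction (_ , v∈E) E≡∅) ]′ (C⊆D+E v∈C)
    ... | yes (e , e∈E) | zero = contradiction (trans (sym (∣p∣≡1+∣p-x∣ e∈E)) ∣E∣≡k) λ ()
    ... | yes (e , e∈E) | suc k = recurse (independent-delete-column e C⊆[D∪E-e]+e P-indep)
      where
      C⊆[D∪E-e]+e : ∀ {v} → v ∈ C → v ∈ D ∪ (E - e) ⊎ v ≡ e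
      C⊆[D∪E-e]+e {v} v∈C with C⊆D+E v∈C
      ... | inj₁ v∈D = inj₁ (x∈p∪q⁺ (inj₁ v∈D))
      ... | inj₂ v∈E with v Fin.≟ e
      ...   | yes v≡e = inj₂ v≡e
      ...   | no  v≢e = inj₁ (x∈p∪q⁺ (inj₂ (x∈p∧x≢y⇒x∈p-y v∈E v≢e)))

      ∣E-e∣≡k : ∣ E - e ∣ ≡ k
      ∣E-e∣≡k = suc-injective (trans (sym (∣p∣≡1+∣p-x∣ e∈E)) ∣E∣≡k)

      recurse : ∃[ P' ] P' ⊆ P × ∣ P ∣ ≤ suc ∣ P' ∣ × Independent M (D ∪ (E - e)) P' →
                ∃[ R ] R ⊆ P × ∣ P ∣ ≤ ∣ R ∣ + suc k × Independent M D R
      recurse (P' , P'⊆P , ∣P∣≤1+∣P'∣ , P'-indep)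
        with go k (E - e) ∣E-e∣≡k (x∈p∪q⁻ D (E - e)) P'-indep
      ... | R , R⊆P' , ∣P'∣≤∣R∣+k , R-indep = R , P'⊆P ∘ R⊆P' , ∣P∣≤∣R∣+1+k , R-indep
        where
        open ≤-Reasoning
        ∣P∣≤∣R∣+1+k : ∣ P ∣ ≤ ∣ R ∣ + suc k
        ∣P∣≤∣R∣+1+k = begin
          ∣ P ∣           ≤⟨ ∣P∣≤1+∣P'∣ ⟩
          suc ∣ P' ∣      ≤⟨ s≤s ∣P'∣≤∣R∣+k ⟩
          suc (∣ R ∣ + k) ≡⟨ +-suc ∣ R ∣ k ⟨
          ∣ R ∣ + suc k   ∎

T-not∨not : ∀ {a b} → T (not a ∨ not b) ⇔ (T a → ¬ T b)
T-not∨not {false}        = mk⇔ (λ _ ()) (λ _ → _)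
T-not∨not {true} {false} = mk⇔ (λ _ _ ()) (λ _ → _)
T-not∨not {true} {true}  = mk⇔ (λ ()) (λ f → f _ _)

¬T⇔≡false : ∀ {b} → (¬ T b) ⇔ b ≡ false
¬T⇔≡false {false} = mk⇔ (λ _ → refl) (λ _ ())
¬T⇔≡false {true}  = mk⇔ (λ ¬t → contradiction _ ¬t) (λ ())

T-⊆ᵇ : ∀ {p q : Subset n} → T (p ⊆ᵇ q) ⇔ p ⊆ q
T-⊆ᵇ = mk⇔ sound complete
  where
  sound : ∀ {n} {p q : Subset n} → T (p ⊆ᵇ q) → p ⊆ q
  sound {p = outside ∷ p} {_       ∷ q} t = out⊆ (sound (proj₂ (to T-∧ t)))
  sound {p = inside  ∷ p} {inside  ∷ q} t = in⊆in (sound t)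
  complete : ∀ {n} {p q : Subset n} → p ⊆ q → T (p ⊆ᵇ q)
  complete {p = []}          {[]}          _   = _
  complete {p = outside ∷ p} {_       ∷ q} p⊆q = from T-∧ (_ , complete (drop-∷-⊆ p⊆q))
  complete {p = inside  ∷ p} {inside  ∷ q} p⊆q = complete (drop-∷-⊆ p⊆q)
  complete {p = inside  ∷ p} {outside ∷ q} p⊆q with p⊆q here
  ... | ()

T-nonempty : ∀ {p : Subset n} → T (nonempty p) ⇔ Nonempty p
T-nonempty = mk⇔ sound complete
  where
  sound : ∀ {n} {p : Subset n} → T (nonempty p) → Nonempty p
  sound {p = inside  ∷ p} _ = zero , here
  sound {p = outside ∷ p} t = Data.Product.map suc there (sound t)
  complete : ∀ {n} {p : Subset n} → Nonempty p → T (nonempty p)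
  complete {p = inside  ∷ p} _                 = _
  complete {p = outside ∷ p} (suc x , there x∈p) = complete (x , x∈p)

T-allᵇ : ∀ {f : Fin n → Bool} → T (allᵇ f) ⇔ (∀ i → T (f i))
T-allᵇ = mk⇔ sound complete
  where
  sound : ∀ {n} {f : Fin n → Bool} → T (allᵇ f) → ∀ i → T (f i)
  sound t zero    = proj₁ (to T-∧ t)
  sound t (suc i) = sound (proj₂ (to T-∧ t)) i
  complete : ∀ {n} {f : Fin n → Bool} → (∀ i → T (f i)) → T (allᵇ f)
  complete {zero}  _  = _
  complete {suc n} tf = from T-∧ (tf zero , complete (tf ∘ suc))

xorSum≡∑ : ∀ (f : Fin n → Bool) → xorSum f ≡ ∑ f
xorSum≡∑ {zero}  f = refl
xorSum≡∑ {suc n} f = cong (f zero xor_) (xorSum≡∑ (f ∘ suc))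

T-combZero : ∀ {M : Matrix n} {C R} → T (combZero M C R) ⇔ Vanishes M C R
T-combZero {M = M} {C} {R} = mk⇔
  (λ t {v} → to (column v) (to T-allᵇ t v))
  (λ R-van → from T-allᵇ (λ v → from (column v) R-van))
  where
  column : ∀ v → T (not (v ∈ₛ C) ∨ not (xorSum (λ u → (u ∈ₛ R) ∧ M u v)))
                 ⇔ (v ∈ C → rowSum M R v ≡ false)
  column v = mk⇔
    (λ t v∈C → trans (sym xorSum≡rowSum) (to ¬T⇔≡false (to T-not∨not t (from T-lookup v∈C))))
    (λ R-van → from T-not∨not (λ t → from ¬T⇔≡false (trans xorSum≡rowSum (R-van (to T-lookup t)))))
    where
    xorSum≡rowSum : xorSum (λ u → (u ∈ₛ R) ∧ M u v) ≡ rowSum M R v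
    xorSum≡rowSum = xorSum≡∑ (λ u → (u ∈ₛ R) ∧ M u v)

∈-subsets : ∀ (p : Subset n) → p ∈ˡ subsets n
∈-subsets []            = Any.here refl
∈-subsets (outside ∷ p) = ∈-++⁺ˡ (∈-map⁺ (outside ∷_) (∈-subsets p))
∈-subsets (inside  ∷ p) = ∈-++⁺ʳ _ (∈-map⁺ (inside ∷_) (∈-subsets p))

T-rowsIndep : ∀ {M : Matrix n} {C R} → T (rowsIndep M C R) ⇔ Independent M C R
T-rowsIndep {n} {M} {C} {R} = mk⇔ sound complete
  where
  admissible : Subset n → Bool
  admissible R' = not (R' ⊆ᵇ R ∧ nonempty R') ∨ not (combZero M C R')

  rowsIndep≡all : rowsIndep M C R ≡ all admissible (subsets n)
  rowsIndep≡all = sym (foldr-map _∧_ admissible true (subsets n))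

  sound : T (rowsIndep M C R) → Independent M C R
  sound t (R' , R'⊆R , R'≢∅ , R'-van) = to T-not∨not R'-admissible
    (from T-∧ (from T-⊆ᵇ R'⊆R , from T-nonempty R'≢∅)) (from (T-combZero {M = M} {C} {R'}) R'-van)
    where
    R'-admissible : T (admissible R')
    R'-admissible = All.lookup (all⁺ admissible (subsets n) (subst T rowsIndep≡all t)) (∈-subsets R')

  complete : Independent M C R → T (rowsIndep M C R)
  complete R-indep = subst T (sym rowsIndep≡all) (all⁻ admissible {subsets n}
    (All.tabulate λ {R'} _ → from T-not∨not λ t₁ t₂ →
      R-indep ( R' , to T-⊆ᵇ (proj₁ (to T-∧ t₁)) , to T-nonempty (proj₂ (to T-∧ t₁))
              , to (T-combZero {M = M} {C} {R'}) t₂ )))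

∈-filterᵇ-subsets : ∀ {n} {p : Subset n → Bool} {X} → X ∈ˡ filterᵇ p (subsets n) ⇔ T (p X)
∈-filterᵇ-subsets {n} {p} {X} =
  mk⇔ (proj₂ ∘ ∈-filter⁻ (T? ∘ p) {xs = subsets n}) (∈-filter⁺ (T? ∘ p) (∈-subsets X))

-- Rank

independentRowSets : ∀ {n} → Matrix n → Subset n → List (Subset n)
independentRowSets {n} M S = filterᵇ (λ R → R ⊆ᵇ S ∧ rowsIndep M S R) (subsets n)

∈-independentRowSets : ∀ {M : Matrix n} {S R} →
  R ∈ˡ independentRowSets M S ⇔ (R ⊆ S × Independent M S R)
∈-independentRowSets {M = M} {S} {R} = mk⇔ sound complete
  where
  sound : R ∈ˡ independentRowSets M S → R ⊆ S × Independent M S R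
  sound R∈ = let t₁ , t₂ = to T-∧ (to ∈-filterᵇ-subsets R∈) in to T-⊆ᵇ t₁ , to T-rowsIndep t₂
  complete : R ⊆ S × Independent M S R → R ∈ˡ independentRowSets M S
  complete (R⊆S , R-indep) =
    from ∈-filterᵇ-subsets (from T-∧ (from T-⊆ᵇ R⊆S , from T-rowsIndep R-indep))

rank-bound : ∀ {M : Matrix n} {S R} → R ⊆ S → Independent M S R → ∣ R ∣ ≤ rank M S
rank-bound R⊆S R-indep = ∈⇒≤maxL (∈-map⁺ ∣_∣ (from ∈-independentRowSets (R⊆S , R-indep)))

rank-attained : ∀ (M : Matrix n) S → ∃[ R ] R ⊆ S × Independent M S R × ∣ R ∣ ≡ rank M S
rank-attained {n} M S with foldr-selective ⊔-sel 0 (map ∣_∣ (independentRowSets M S))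
... | inj₁ rank≡0 = ⊥ , ⊥⊆ , ⊥-indep , trans (∣⊥∣≡0 n) (sym rank≡0)
  where
  ⊥-indep : Independent M S ⊥
  ⊥-indep (_ , T'⊆⊥ , (_ , t∈T') , _) = ∉⊥ (T'⊆⊥ t∈T')
... | inj₂ rank∈ with ∈-map⁻ ∣_∣ rank∈
...   | R , R∈ , rank≡∣R∣ with to ∈-independentRowSets R∈
...     | R⊆S , R-indep = R , R⊆S , R-indep , sym rank≡∣R∣

-- Principal submatrices of symmetric matrices

InSpan : Matrix n → (columns rows : Subset n) → Fin n → Set
InSpan M C R u = ∃[ U ] U ⊆ R × (∀ {v} → v ∈ C → M u v ≡ rowSum M U v)

independent∧dependent-∪⁅⁆⇒inSpan : ∀ {M : Matrix n} {C R u} →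
  Independent M C R → Dependent M C (R ∪ ⁅ u ⁆) → InSpan M C R u
independent∧dependent-∪⁅⁆⇒inSpan {M = M} {C} {R} {u} R-indep (T' , T'⊆R∪u , T'≢∅ , T'-van)
  with u ∈? T'
... | no u∉T' = ⊥-elim (R-indep (T' , T'⊆R , T'≢∅ , T'-van))
  where
  T'⊆R : T' ⊆ R
  T'⊆R x∈T' = x∈p∪⁅y⁆∧x≢y⇒x∈p (T'⊆R∪u x∈T') (λ { refl → u∉T' x∈T' })
... | yes u∈T' = T' △ ⁅ u ⁆ , U⊆R , row-u
  where
  x∈U⇒x≢u : ∀ {x} → x ∈ T' △ ⁅ u ⁆ → x ≢ u
  x∈U⇒x≢u x∈U refl = x∈p∧x∈q⇒x∉p△q u∈T' (x∈⁅x⁆ u) x∈U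
  U⊆R : T' △ ⁅ u ⁆ ⊆ R
  U⊆R {x} x∈U = x∈p∪⁅y⁆∧x≢y⇒x∈p (T'⊆R∪u x∈T') (x∈U⇒x≢u x∈U)
    where
    x∈T' : x ∈ T'
    x∈T' = [ id , (λ x∈⁅u⁆ → contradiction (x∈⁅y⁆⇒x≡y u x∈⁅u⁆) (x∈U⇒x≢u x∈U)) ]′ (x∈p△q⁻ x∈U)
  row-u : ∀ {v} → v ∈ C → M u v ≡ rowSum M (T' △ ⁅ u ⁆) v
  row-u {v} v∈C = sym (trans (sumOver-△ T' ⁅ u ⁆ (λ w → M w v))
                             (cong₂ _xor_ (T'-van v∈C) (sumOver-⁅⁆ u (λ w → M w v))))

sumOver-rowSum-comm : ∀ {M : Matrix n} → IsSymmetric M →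
  ∀ T₁ T₂ → sumOver T₁ (rowSum M T₂) ≡ sumOver T₂ (rowSum M T₁)
sumOver-rowSum-comm {M = M} M-sym T₁ T₂ =
  trans (sumOver-comm T₁ T₂ M) (sumOver-cong T₂ (λ {u} _ → sumOver-cong T₁ (λ {t} _ → M-sym u t)))

spanning-rows⇒nonsingular-principal : ∀ {M : Matrix n} {S R} → IsSymmetric M → R ⊆ S →
  (∀ {u} → u ∈ S → InSpan M S R u) → Independent M S R → Independent M R R
spanning-rows⇒nonsingular-principal {M = M} {S} {R} M-sym R⊆S spans R-indep
  (T' , T'⊆R , T'≢∅ , T'-van) =
  R-indep (T' , T'⊆R , T'≢∅ , T'-van-on-S)
  where
  open ≡-Reasoning
  -- By symmetry, column c of M restricted to R is a combination of the columns U ⊆ R.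
  T'-van-on-S : Vanishes M S T'
  T'-van-on-S {c} c∈S with spans c∈S
  ... | U , U⊆R , row-c = begin
    rowSum M T' c            ≡⟨ sumOver-cong T' (λ {t} _ → M-sym t c) ⟩
    sumOver T' (M c)         ≡⟨ sumOver-cong T' (λ t∈T' → row-c (R⊆S (T'⊆R t∈T'))) ⟩
    sumOver T' (rowSum M U)  ≡⟨ sumOver-rowSum-comm M-sym T' U ⟩
    sumOver U (rowSum M T')  ≡⟨ sumOver-zero U (λ u∈U → T'-van (U⊆R u∈U)) ⟩
    false                    ∎

nonsingular-principal-submatrix : ∀ {M : Matrix n} → IsSymmetric M →
  ∀ S → ∃[ X ] X ⊆ S × Independent M X X × ∣ X ∣ ≡ rank M S
nonsingular-principal-submatrix {M = M} M-sym S with rank-attained M S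
... | R , R⊆S , R-indep , ∣R∣≡rank =
  R , R⊆S , spanning-rows⇒nonsingular-principal M-sym R⊆S inSpan R-indep , ∣R∣≡rank
  where
  inSpan : ∀ {u} → u ∈ S → InSpan M S R u
  inSpan {u} u∈S with u ∈? R
  ... | yes u∈R = ⁅ u ⁆ , (λ x∈⁅u⁆ → subst (_∈ R) (sym (x∈⁅y⁆⇒x≡y u x∈⁅u⁆)) u∈R)
                        , (λ {v} _ → sym (sumOver-⁅⁆ u (λ w → M w v)))
  ... | no u∉R with dependent? {M = M} S (R ∪ ⁅ u ⁆)
  ...   | yes R∪u-dep = independent∧dependent-∪⁅⁆⇒inSpan R-indep R∪u-dep
  ...   | no R∪u-indep = contradiction (p⊂q⇒∣p∣<∣q∣ R⊂R∪u) (≤⇒≯ ∣R∪u∣≤∣R∣)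
    where
    R⊂R∪u : R ⊂ R ∪ ⁅ u ⁆
    R⊂R∪u = p⊆p∪q ⁅ u ⁆ , u , x∈p∪q⁺ (inj₂ (x∈⁅x⁆ u)) , u∉R
    R∪u⊆S : R ∪ ⁅ u ⁆ ⊆ S
    R∪u⊆S x∈ =
      [ R⊆S , (λ x∈⁅u⁆ → subst (_∈ S) (sym (x∈⁅y⁆⇒x≡y u x∈⁅u⁆)) u∈S) ]′ (x∈p∪q⁻ R ⁅ u ⁆ x∈)
    ∣R∪u∣≤∣R∣ : ∣ R ∪ ⁅ u ⁆ ∣ ≤ ∣ R ∣
    ∣R∪u∣≤∣R∣ = subst (∣ R ∪ ⁅ u ⁆ ∣ ≤_) (sym ∣R∣≡rank) (rank-bound R∪u⊆S R∪u-indep)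

-- The width of a twisted set system

width-twist-≡ : ∀ {D : SetSystem n} {A lo hi} →
  (∀ {X} → X ∈ˡ D → lo ≤ ∣ X △ A ∣ × ∣ X △ A ∣ ≤ hi) →
  (∃[ X ] X ∈ˡ D × ∣ X △ A ∣ ≡ lo) → (∃[ X ] X ∈ˡ D × ∣ X △ A ∣ ≡ hi) →
  width (D *ₛ A) ≡ hi ∸ lo
width-twist-≡ {D = D} {A} bounds (X-lo , X-lo∈D , ∣X-lo△A∣≡lo) (X-hi , X-hi∈D , ∣X-hi△A∣≡hi) =
  cong₂ _∸_ (maxL-≡ (attained X-hi∈D ∣X-hi△A∣≡hi) (bounded (proj₂ ∘ bounds)))
            (minL-≡ (attained X-lo∈D ∣X-lo△A∣≡lo) (bounded (proj₁ ∘ bounds)))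
  where
  attained : ∀ {X m} → X ∈ˡ D → ∣ X △ A ∣ ≡ m → m ∈ˡ map ∣_∣ (D *ₛ A)
  attained X∈D refl = ∈-map⁺ ∣_∣ (∈-map⁺ (_△ A) X∈D)
  bounded : ∀ {P : ℕ → Set} → (∀ {X} → X ∈ˡ D → P ∣ X △ A ∣) → All P (map ∣_∣ (D *ₛ A))
  bounded P-on-D = map⁺ (map⁺ (All.tabulate P-on-D))

nonsingularSets : ∀ {n} → Matrix n → SetSystem n
nonsingularSets {n} M = filterᵇ (nonsingular M) (subsets n)

∈-nonsingularSets : ∀ {M : Matrix n} {X} → X ∈ˡ nonsingularSets M ⇔ Independent M X X
∈-nonsingularSets =
  mk⇔ (to T-rowsIndep ∘ to ∈-filterᵇ-subsets) (from ∈-filterᵇ-subsets ∘ from T-rowsIndep)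

∣X∩B∣≤rank[B]+∣X∩B′∣ : ∀ {M : Matrix n} {X} B B′ → Independent M X X →
  (∀ {v} → v ∈ X → v ∈ B ⊎ v ∈ B′) → ∣ X ∩ B ∣ ≤ rank M B + ∣ X ∩ B′ ∣
∣X∩B∣≤rank[B]+∣X∩B′∣ {M = M} {X} B B′ X-indep X⊆B∪B′ =
  bound (independent-delete-columns (X ∩ B′) split (independent-antitone-rows (p∩q⊆p X B) X-indep))
  where
  split : ∀ {v} → v ∈ X → v ∈ X ∩ B ⊎ v ∈ X ∩ B′
  split v∈X = Data.Sum.map (λ v∈B → x∈p∩q⁺ (v∈X , v∈B)) (λ v∈B′ → x∈p∩q⁺ (v∈X , v∈B′)) (X⊆B∪B′ v∈X)
  bound : ∃[ R ] R ⊆ X ∩ B × ∣ X ∩ B ∣ ≤ ∣ R ∣ + ∣ X ∩ B′ ∣ × Independent M (X ∩ B) R →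
          ∣ X ∩ B ∣ ≤ rank M B + ∣ X ∩ B′ ∣
  bound (R , R⊆X∩B , ∣X∩B∣≤∣R∣+∣X∩B′∣ , R-indep) = ≤-trans ∣X∩B∣≤∣R∣+∣X∩B′∣
    (+-monoˡ-≤ ∣ X ∩ B′ ∣ (rank-bound (p∩q⊆q X B ∘ R⊆X∩B)
                                       (independent-monotone-columns (p∩q⊆q X B) R-indep)))

module _ {M : Matrix n} {X : Subset n} (X-indep : Independent M X X) (A : Subset n) where

  open ≤-Reasoning

  ∣A∣∸rank[A]≤∣X△A∣ : ∣ A ∣ ∸ rank M A ≤ ∣ X △ A ∣
  ∣A∣∸rank[A]≤∣X△A∣ = m≤n+o⇒m∸n≤o ∣ A ∣ (rank M A) (+-cancelʳ-≤ ∣ X ∩ ∁ A ∣ ∣ A ∣ _ (begin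
    ∣ A ∣ + ∣ X ∩ ∁ A ∣                   ≡⟨ ∣p△q∣+∣p∩q∣≡∣q∣+∣p∩∁q∣ X A ⟨
    ∣ X △ A ∣ + ∣ X ∩ A ∣                 ≤⟨ +-monoʳ-≤ ∣ X △ A ∣ ∣X∩A∣≤ ⟩
    ∣ X △ A ∣ + (rank M A + ∣ X ∩ ∁ A ∣)  ≡⟨ +-assoc ∣ X △ A ∣ (rank M A) _ ⟨
    ∣ X △ A ∣ + rank M A + ∣ X ∩ ∁ A ∣    ≡⟨ cong (_+ ∣ X ∩ ∁ A ∣) (+-comm ∣ X △ A ∣ (rank M A)) ⟩
    rank M A + ∣ X △ A ∣ + ∣ X ∩ ∁ A ∣    ∎))
    where
    ∣X∩A∣≤ : ∣ X ∩ A ∣ ≤ rank M A + ∣ X ∩ ∁ A ∣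
    ∣X∩A∣≤ = ∣X∩B∣≤rank[B]+∣X∩B′∣ A (∁ A) X-indep (λ {v} _ → ∈⊎∈∁ A v)

  ∣X△A∣≤∣A∣+rank[∁A] : ∣ X △ A ∣ ≤ ∣ A ∣ + rank M (∁ A)
  ∣X△A∣≤∣A∣+rank[∁A] = +-cancelʳ-≤ ∣ X ∩ A ∣ ∣ X △ A ∣ _ (begin
    ∣ X △ A ∣ + ∣ X ∩ A ∣               ≡⟨ ∣p△q∣+∣p∩q∣≡∣q∣+∣p∩∁q∣ X A ⟩
    ∣ A ∣ + ∣ X ∩ ∁ A ∣                 ≤⟨ +-monoʳ-≤ ∣ A ∣ ∣X∩∁A∣≤ ⟩
    ∣ A ∣ + (rank M (∁ A) + ∣ X ∩ A ∣)  ≡⟨ +-assoc ∣ A ∣ (rank M (∁ A)) _ ⟨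
    ∣ A ∣ + rank M (∁ A) + ∣ X ∩ A ∣    ∎)
    where
    ∣X∩∁A∣≤ : ∣ X ∩ ∁ A ∣ ≤ rank M (∁ A) + ∣ X ∩ A ∣
    ∣X∩∁A∣≤ = ∣X∩B∣≤rank[B]+∣X∩B′∣ (∁ A) A X-indep (λ {v} _ → Data.Sum.swap (∈⊎∈∁ A v))

width-twist : ∀ {M : Matrix n} → IsSymmetric M → ∀ A →
  width (nonsingularSets M *ₛ A) ≡ rank M A + rank M (∁ A)
width-twist {M = M} M-sym A
  with nonsingular-principal-submatrix M-sym A | nonsingular-principal-submatrix M-sym (∁ A)
... | X₀ , X₀⊆A , X₀-indep , ∣X₀∣≡r | X₁ , X₁⊆∁A , X₁-indep , ∣X₁∣≡r∁ = begin
  width (nonsingularSets M *ₛ A)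
    ≡⟨ width-twist-≡ bounds (X₀ , from ∈-nonsingularSets X₀-indep , ∣X₀△A∣)
                            (X₁ , from ∈-nonsingularSets X₁-indep , ∣X₁△A∣) ⟩
  (∣ A ∣ + r∁) ∸ (∣ A ∣ ∸ r)  ≡⟨ +-∸-comm r∁ (m∸n≤m ∣ A ∣ r) ⟩
  ∣ A ∣ ∸ (∣ A ∣ ∸ r) + r∁    ≡⟨ cong (_+ r∁) (m∸[m∸n]≡n r≤∣A∣) ⟩
  r + r∁                     ∎
  where
  open ≡-Reasoning
  r r∁ : ℕ
  r = rank M A
  r∁ = rank M (∁ A)
  bounds : ∀ {X} → X ∈ˡ nonsingularSets M → ∣ A ∣ ∸ r ≤ ∣ X △ A ∣ × ∣ X △ A ∣ ≤ ∣ A ∣ + r∁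
  bounds X∈ = let X-indep = to ∈-nonsingularSets X∈ in
    ∣A∣∸rank[A]≤∣X△A∣ X-indep A , ∣X△A∣≤∣A∣+rank[∁A] X-indep A
  r≤∣A∣ : r ≤ ∣ A ∣
  r≤∣A∣ = subst (_≤ ∣ A ∣) ∣X₀∣≡r (p⊆q⇒∣p∣≤∣q∣ X₀⊆A)
  ∣X₀△A∣ : ∣ X₀ △ A ∣ ≡ ∣ A ∣ ∸ r
  ∣X₀△A∣ = trans (sym (m+n∸n≡m ∣ X₀ △ A ∣ ∣ X₀ ∣)) (cong₂ _∸_ (p⊆q⇒∣p△q∣+∣p∣≡∣q∣ X₀⊆A) ∣X₀∣≡r)
  ∣X₁△A∣ : ∣ X₁ △ A ∣ ≡ ∣ A ∣ + r∁
  ∣X₁△A∣ = trans (p⊆∁q⇒∣p△q∣≡∣q∣+∣p∣ X₁⊆∁A) (cong (∣ A ∣ +_) ∣X₁∣≡r∁)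

proposition3p3 : ∀ {n} (G : LoopedSimpleGraph n) →
    ((A : Subset n) →
      width (DG G *ₛ A) ≡ rank (adjMatrix G) A + rank (adjMatrix G) (∁ A))
    × ((z : ℕ) →
      TG G z ≡ sum (map (λ A → z ^ (rank (adjMatrix G) A + rank (adjMatrix G) (∁ A))) (subsets n)))
proposition3p3 {n} G = width-DG , λ z → cong sum (map-cong (cong (z ^_) ∘ width-DG) (subsets n))
  where
  width-DG : ∀ A → width (DG G *ₛ A) ≡ rank (adjMatrix G) A + rank (adjMatrix G) (∁ A)
  width-DG = width-twist (LoopedSimpleGraph.sym G)
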